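{- Let $\varphi$ be a closed Hyper-maxHML formula and let $T\in\mathsf{HTrc}_{\mathcal L}$. If $T\notin[\![\varphi]\!]$, then $\mathcal M_\emptyset(\varphi)\triangleright T\rightarrowtail^*\mathsf{no}$.
   Context: Model. Fix a finite set $\mathsf{Act}$ of actions with $|\mathsf{Act}|\ge 2$ and a finite non-empty set $\mathcal L$ of locations. Let $\mathsf{Trc}=\mathsf{Act}^\omega$. A hypertrace on $\mathcal L$ is a function $T:\mathcal L\to\mathsf{Trc}$; $\mathsf{HTrc}_{\mathcal L}$ is the set of hypertraces. For $A:\mathcal L\to\mathsf{Act}$ and $T,T'\in\mathsf{HTrc}_{\mathcal L}$ write $T\xrightarrow{A}T'$ iff $T(\ell)=A(\ell)\,T'(\ell)$ for every $\ell\in\mathcal L$; for each $T$ there is exactly one such pair $(A,T')$, written $(hd(T),tl(T))$. Logic. Let $\Pi$ (location variables $\pi$) and $V$ (recursion variables $x$) be disjoint countably infinite sets. Hyper-recHML formulas: $\varphi::=\mathsf{tt}\mid\mathsf{ff}\mid\varphi\wedge\varphi\mid\varphi\vee\varphi\mid\max x.\varphi\mid\min x.\varphi\mid x\mid\exists\pi.\varphi\mid\forall\pi.\varphi\mid\pi=\pi\mid\pi\neq\pi\mid[a_\pi]\varphi\mid\langle a_\pi\rangle\varphi$ with $a\in\mathsf{Act}$. Formulas are guarded (each recursion variable occurs within the scope of a modality inside its binding fixed point), and bound location variables are pairwise distinct and distinct from free ones. $\mathsf{fv_l}(\varphi)$ and $\mathsf{fv_r}(\varphi)$ denote the free location and free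 recursion variables; $\varphi$ is closed if both are empty. Hyper-maxHML is the set of formulas containing no $\min$. For partial maps $\rho:V\rightharpoonup 2^{\mathsf{HTrc}_{\mathcal L}}$ and $\sigma:\Pi\rightharpoonup\mathcal L$ defined on the free recursion/location variables, $[\![\varphi]\!]^\rho_\sigma\subseteq\mathsf{HTrc}_{\mathcal L}$ is: $[\![\mathsf{tt}]\!]^\rho_\sigma=\mathsf{HTrc}_{\mathcal L}$; $[\![\mathsf{ff}]\!]^\rho_\sigma=\emptyset$; $[\![x]\!]^\rho_\sigma=\rho(x)$; $\wedge,\vee$ are intersection and union; $[\![\max x.\psi]\!]^\rho_\sigma=\bigcup\{S\mid S\subseteq[\![\psi]\!]^{\rho[x\mapsto S]}_\sigma\}$; $[\![\min x.\psi]\!]^\rho_\sigma=\bigcap\{S\mid S\supseteq[\![\psi]\!]^{\rho[x\mapsto S]}_\sigma\}$; $[\![\exists\pi.\psi]\!]^\rho_\sigma=\bigcup_{\ell\in\mathcal L}[\![\psi]\!]^\rho_{\sigma[\pi\mapsto\ell]}$; $[\![\forall\pi.\psi]\!]^\rho_\sigma=\bigcap_{\ell\in\mathcal L}[\![\psi]\!]^\rho_{\sigma[\pi\mapsto\ell]}$; $[\![\pi=\pi']\!]^\rho_\sigma$ is $\mathsf{HTrc}_{\mathcal L}$ if $\sigma(\pi)=\sigma(\pi')$ and $\emptyset$ otherwise, dually for $\pi\neq\pi'$; $[\![[a_\pi]\psi]\!]^\rho_\sigma=\{T\mid hd(T)(\sigma(\pi))=a\Rightarrow tl(T)\in[\![\psi]\!]^\rho_\sigma\}$;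 $[\![\langle a_\pi\rangle\psi]\!]^\rho_\sigma=\{T\mid hd(T)(\sigma(\pi))=a\text{ and }tl(T)\in[\![\psi]\!]^\rho_\sigma\}$. For closed $\varphi$, $[\![\varphi]\!]=[\![\varphi]\!]^\emptyset_\emptyset$. Centralized monitors: $m::=\mathsf{yes}\mid\mathsf{no}\mid\mathsf{end}\mid a_\ell.m\mid m+m\mid m\oplus m\mid m\otimes m\mid\mathsf{rec}\,x.m\mid x$ ($a\in\mathsf{Act}$, $\ell\in\mathcal L$, $x\in V$); verdicts $v\in\{\mathsf{yes},\mathsf{no},\mathsf{end}\}$; $\odot$ denotes $\otimes$ or $\oplus$. Transitions $m\xrightarrow{A}m'$ (least relation): $v\xrightarrow{A}v$; $a_\ell.m\xrightarrow{A}m$ if $A(\ell)=a$; $a_\ell.m\xrightarrow{A}\mathsf{end}$ if $A(\ell)\neq a$; $\mathsf{rec}\,x.m\xrightarrow{A}m'$ if $m\{\mathsf{rec}\,x.m/x\}\xrightarrow{A}m'$; $m+n\xrightarrow{A}m'$ if $m\xrightarrow{A}m'$ and $m+n\xrightarrow{A}n'$ if $n\xrightarrow{A}n'$; $m\odot n\xrightarrow{A}m'\odot n'$ if $m\xrightarrow{A}m'$ and $n\xrightarrow{A}n'$. Verdict evaluation $m\Rrightarrow v$ is the least relation closed under these rules (each also with operands of $+,\otimes,\oplus$ swapped): $v\Rrightarrow v$; $m\odot n\Rrightarrow\mathsf{end}$ if $m\Rrightarrow\mathsf{end}$ and $n\Rrightarrow\mathsf{end}$; $m\oplus n\Rrightarrow\mathsf{yes}$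 if $m\Rrightarrow\mathsf{yes}$; $m\otimes n\Rrightarrow\mathsf{no}$ if $m\Rrightarrow\mathsf{no}$; $m+n\Rrightarrow v$ if $m\Rrightarrow v$; $m\oplus n\Rrightarrow v$ if $m\Rrightarrow\mathsf{no}$ and $n\Rrightarrow v$; $m\otimes n\Rrightarrow v$ if $m\Rrightarrow\mathsf{yes}$ and $n\Rrightarrow v$; $\mathsf{rec}\,x.m\Rrightarrow v$ if $m\{\mathsf{rec}\,x.m/x\}\Rrightarrow v$. Instrumentation: $m\triangleright T\rightarrowtail m'\triangleright T'$ if $m\xrightarrow{A}m'$ and $T\xrightarrow{A}T'$ for some $A$; $m\triangleright T\rightarrowtail v$ if $m\Rrightarrow v$; $\rightarrowtail^*$ is the reflexive-transitive closure. Centralized synthesis: for a Hyper-maxHML formula $\varphi$ and $\sigma:\Pi\rightharpoonup\mathcal L$ defined on $\mathsf{fv_l}(\varphi)$: $\mathcal M_\sigma(\mathsf{tt})=\mathsf{yes}$, $\mathcal M_\sigma(\mathsf{ff})=\mathsf{no}$, $\mathcal M_\sigma(x)=x$, $\mathcal M_\sigma(\max x.\varphi)=\mathsf{rec}\,x.\mathcal M_\sigma(\varphi)$, $\mathcal M_\sigma(\varphi\wedge\varphi')=\mathcal M_\sigma(\varphi)\otimes\mathcal M_\sigma(\varphi')$, $\mathcal M_\sigma(\varphi\vee\varphi')=\mathcal M_\sigma(\varphi)\oplus\mathcal M_\sigma(\varphi')$, $\mathcal M_\sigma(\forall\pi.\varphi)=\bigotimes_{\ell\in\mathcal L}\mathcal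 M_{\sigma[\pi\mapsto\ell]}(\varphi)$, $\mathcal M_\sigma(\exists\pi.\varphi)=\bigoplus_{\ell\in\mathcal L}\mathcal M_{\sigma[\pi\mapsto\ell]}(\varphi)$, $\mathcal M_\sigma(\pi=\pi')=\mathsf{yes}$ if $\sigma(\pi)=\sigma(\pi')$ else $\mathsf{no}$, $\mathcal M_\sigma(\pi\neq\pi')=\mathsf{yes}$ if $\sigma(\pi)\neq\sigma(\pi')$ else $\mathsf{no}$, $\mathcal M_\sigma([a_\pi]\varphi)=a_{\sigma(\pi)}.\mathcal M_\sigma(\varphi)+\sum_{b\neq a}b_{\sigma(\pi)}.\mathsf{yes}$, $\mathcal M_\sigma(\langle a_\pi\rangle\varphi)=a_{\sigma(\pi)}.\mathcal M_\sigma(\varphi)+\sum_{b\neq a}b_{\sigma(\pi)}.\mathsf{no}$. -}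

module Defs where

open import Level using (Level; 0ℓ; Lift; lift) renaming (suc to lsuc)
open import Data.Nat using (ℕ; zero; suc)
open import Data.Nat.Properties using () renaming (_≟_ to _≟ℕ_)
open import Data.Fin using (Fin; zero; suc)
open import Data.Fin.Properties using () renaming (_≟_ to _≟F_)
open import Data.List using (List; []; _∷_; map; filter; allFin; _++_)
open import Data.List.Membership.Propositional using (_∈_; _∉_)
open import Data.List.Relation.Unary.Unique.Propositional using (Unique)
open import Data.Product using (Σ; _×_; _,_)
open import Data.Sum using (_⊎_)
open import Data.Unit using (⊤)
open import Data.Empty using (⊥)
open import Function using (_∘_)
open import Relation.Nullary using (¬_; yes; no; ¬?)
open import Relation.Binary.PropositionalEquality using (_≡_; _≢_)
open import Relation.Binary.Construct.Closure.ReflexiveTransitive using (Star)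

Act : ℕ → Set
Act na = Fin (suc (suc na))

Loc : ℕ → Set
Loc nl = Fin (suc nl)

Trc : ℕ → Set
Trc na = ℕ → Act na

HTrc : ℕ → ℕ → Set
HTrc na nl = Loc nl → Trc na

TStep : ∀ {na nl} → HTrc na nl → (Loc nl → Act na) → HTrc na nl → Set
TStep T A T' = ∀ ℓ → (T ℓ 0 ≡ A ℓ) × (∀ k → T ℓ (suc k) ≡ T' ℓ k)

hd : ∀ {na nl} → HTrc na nl → Loc nl → Act na
hd T ℓ = T ℓ 0

tl : ∀ {na nl} → HTrc na nl → HTrc na nl
tl T ℓ k = T ℓ (suc k)

-- Hyper-recHML syntax; location variables Π = ℕ, recursion variables V = ℕ
-- (separate syntactic categories, hence disjoint)

data Form (na : ℕ) : Set where
  TT FF        : Form na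
  _∧ᶠ_ _∨ᶠ_    : Form na → Form na → Form na
  max min      : ℕ → Form na → Form na
  var          : ℕ → Form na
  exs alls     : ℕ → Form na → Form na
  _=ᶠ_ _≠ᶠ_    : ℕ → ℕ → Form na
  box dia      : Act na → ℕ → Form na → Form na

MaxOnly : ∀ {na} → Form na → Set
MaxOnly TT = ⊤
MaxOnly FF = ⊤
MaxOnly (φ ∧ᶠ ψ) = MaxOnly φ × MaxOnly ψ
MaxOnly (φ ∨ᶠ ψ) = MaxOnly φ × MaxOnly ψ
MaxOnly (max x φ) = MaxOnly φ
MaxOnly (min x φ) = ⊥
MaxOnly (var x) = ⊤
MaxOnly (exs π φ) = MaxOnly φ
MaxOnly (alls π φ) = MaxOnly φ
MaxOnly (π =ᶠ π') = ⊤
MaxOnly (π ≠ᶠ π') = ⊤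
MaxOnly (box a π φ) = MaxOnly φ
MaxOnly (dia a π φ) = MaxOnly φ

ClosedIn : ∀ {na} → List ℕ → List ℕ → Form na → Set
ClosedIn Ls Xs TT = ⊤
ClosedIn Ls Xs FF = ⊤
ClosedIn Ls Xs (φ ∧ᶠ ψ) = ClosedIn Ls Xs φ × ClosedIn Ls Xs ψ
ClosedIn Ls Xs (φ ∨ᶠ ψ) = ClosedIn Ls Xs φ × ClosedIn Ls Xs ψ
ClosedIn Ls Xs (max x φ) = ClosedIn Ls (x ∷ Xs) φ
ClosedIn Ls Xs (min x φ) = ClosedIn Ls (x ∷ Xs) φ
ClosedIn Ls Xs (var x) = x ∈ Xs
ClosedIn Ls Xs (exs π φ) = ClosedIn (π ∷ Ls) Xs φ
ClosedIn Ls Xs (alls π φ) = ClosedIn (π ∷ Ls) Xs φ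
ClosedIn Ls Xs (π =ᶠ π') = π ∈ Ls × π' ∈ Ls
ClosedIn Ls Xs (π ≠ᶠ π') = π ∈ Ls × π' ∈ Ls
ClosedIn Ls Xs (box a π φ) = π ∈ Ls × ClosedIn Ls Xs φ
ClosedIn Ls Xs (dia a π φ) = π ∈ Ls × ClosedIn Ls Xs φ

Closed : ∀ {na} → Form na → Set
Closed = ClosedIn [] []

-- GuardedIn G φ : the variables in G (bound by an enclosing fixed point, with no
-- modality in between) do not occur unguarded in φ.
GuardedIn : ∀ {na} → List ℕ → Form na → Set
GuardedIn G TT = ⊤
GuardedIn G FF = ⊤
GuardedIn G (φ ∧ᶠ ψ) = GuardedIn G φ × GuardedIn G ψ
GuardedIn G (φ ∨ᶠ ψ) = GuardedIn G φ × GuardedIn G ψ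
GuardedIn G (max x φ) = GuardedIn (x ∷ G) φ
GuardedIn G (min x φ) = GuardedIn (x ∷ G) φ
GuardedIn G (var x) = x ∉ G
GuardedIn G (exs π φ) = GuardedIn G φ
GuardedIn G (alls π φ) = GuardedIn G φ
GuardedIn G (π =ᶠ π') = ⊤
GuardedIn G (π ≠ᶠ π') = ⊤
GuardedIn G (box a π φ) = GuardedIn [] φ
GuardedIn G (dia a π φ) = GuardedIn [] φ

Guarded : ∀ {na} → Form na → Set
Guarded = GuardedIn []

boundLocs : ∀ {na} → Form na → List ℕ
boundLocs TT = []
boundLocs FF = []
boundLocs (φ ∧ᶠ ψ) = boundLocs φ ++ boundLocs ψ
boundLocs (φ ∨ᶠ ψ) = boundLocs φ ++ boundLocs ψ
boundLocs (max x φ) = boundLocs φ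
boundLocs (min x φ) = boundLocs φ
boundLocs (var x) = []
boundLocs (exs π φ) = π ∷ boundLocs φ
boundLocs (alls π φ) = π ∷ boundLocs φ
boundLocs (π =ᶠ π') = []
boundLocs (π ≠ᶠ π') = []
boundLocs (box a π φ) = boundLocs φ
boundLocs (dia a π φ) = boundLocs φ

DistinctBound : ∀ {na} → Form na → Set
DistinctBound φ = Unique (boundLocs φ)

-- Environments (total maps; the empty environment is modelled by a
-- constant default, irrelevant for closed formulas)

upd : ∀ {a} {A : Set a} → (ℕ → A) → ℕ → A → (ℕ → A)
upd f x v y with y ≟ℕ x
... | yes _ = v
... | no  _ = f y

Pred0 : ℕ → ℕ → Set₁
Pred0 na nl = HTrc na nl → Set

⟦_⟧ : ∀ {na nl} → Form na → (ℕ → Pred0 na nl) → (ℕ → Loc nl) → HTrc na nl → Set₁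
⟦ TT ⟧ ρ σ T = Lift (lsuc 0ℓ) ⊤
⟦ FF ⟧ ρ σ T = Lift (lsuc 0ℓ) ⊥
⟦ φ ∧ᶠ ψ ⟧ ρ σ T = ⟦ φ ⟧ ρ σ T × ⟦ ψ ⟧ ρ σ T
⟦ φ ∨ᶠ ψ ⟧ ρ σ T = ⟦ φ ⟧ ρ σ T ⊎ ⟦ ψ ⟧ ρ σ T
⟦ max x ψ ⟧ ρ σ T =
  Σ (Pred0 _ _) λ S → (∀ T' → S T' → ⟦ ψ ⟧ (upd ρ x S) σ T') × S T
⟦ min x ψ ⟧ ρ σ T =
  ∀ (S : Pred0 _ _) → (∀ T' → ⟦ ψ ⟧ (upd ρ x S) σ T' → Lift (lsuc 0ℓ) (S T')) → Lift (lsuc 0ℓ) (S T)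
⟦ var x ⟧ ρ σ T = Lift (lsuc 0ℓ) (ρ x T)
⟦ exs π ψ ⟧ ρ σ T = Σ (Loc _) λ ℓ → ⟦ ψ ⟧ ρ (upd σ π ℓ) T
⟦ alls π ψ ⟧ ρ σ T = ∀ ℓ → ⟦ ψ ⟧ ρ (upd σ π ℓ) T
⟦ π =ᶠ π' ⟧ ρ σ T = Lift (lsuc 0ℓ) (σ π ≡ σ π')
⟦ π ≠ᶠ π' ⟧ ρ σ T = Lift (lsuc 0ℓ) (σ π ≢ σ π')
⟦ box a π ψ ⟧ ρ σ T = hd T (σ π) ≡ a → ⟦ ψ ⟧ ρ σ (tl T)
⟦ dia a π ψ ⟧ ρ σ T = Lift (lsuc 0ℓ) (hd T (σ π) ≡ a) × ⟦ ψ ⟧ ρ σ (tl T)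

ρ∅ : ∀ {na nl} → ℕ → Pred0 na nl
ρ∅ _ _ = ⊥

σ∅ : ∀ {nl} → ℕ → Loc nl
σ∅ _ = zero

⟦_⟧∅ : ∀ {na nl} → Form na → HTrc na nl → Set₁
⟦ φ ⟧∅ = ⟦ φ ⟧ ρ∅ σ∅

data Verdict : Set where
  Yes No End : Verdict

data Mon (na nl : ℕ) : Set where
  verd        : Verdict → Mon na nl
  pre         : Act na → Loc nl → Mon na nl → Mon na nl
  _+ₘ_ _⊕_ _⊗_ : Mon na nl → Mon na nl → Mon na nl
  rec         : ℕ → Mon na nl → Mon na nl
  mvar        : ℕ → Mon na nl

_[_/_] : ∀ {na nl} → Mon na nl → Mon na nl → ℕ → Mon na nl
verd v [ n / x ] = verd v
pre a ℓ m [ n / x ] = pre a ℓ (m [ n / x ])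
(m +ₘ m') [ n / x ] = (m [ n / x ]) +ₘ (m' [ n / x ])
(m ⊕ m') [ n / x ] = (m [ n / x ]) ⊕ (m' [ n / x ])
(m ⊗ m') [ n / x ] = (m [ n / x ]) ⊗ (m' [ n / x ])
rec y m [ n / x ] with y ≟ℕ x
... | yes _ = rec y m
... | no  _ = rec y (m [ n / x ])
mvar y [ n / x ] with y ≟ℕ x
... | yes _ = n
... | no  _ = mvar y

data _─[_]→_ {na nl : ℕ} : Mon na nl → (Loc nl → Act na) → Mon na nl → Set where
  vS    : ∀ {v A} → verd v ─[ A ]→ verd v
  preT  : ∀ {a ℓ m A} → A ℓ ≡ a → pre a ℓ m ─[ A ]→ m
  preF  : ∀ {a ℓ m A} → A ℓ ≢ a → pre a ℓ m ─[ A ]→ verd End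
  recS  : ∀ {x m m' A} → (m [ rec x m / x ]) ─[ A ]→ m' → rec x m ─[ A ]→ m'
  plusL : ∀ {m n m' A} → m ─[ A ]→ m' → (m +ₘ n) ─[ A ]→ m'
  plusR : ∀ {m n n' A} → n ─[ A ]→ n' → (m +ₘ n) ─[ A ]→ n'
  oplusS : ∀ {m n m' n' A} → m ─[ A ]→ m' → n ─[ A ]→ n' → (m ⊕ n) ─[ A ]→ (m' ⊕ n')
  otimesS : ∀ {m n m' n' A} → m ─[ A ]→ m' → n ─[ A ]→ n' → (m ⊗ n) ─[ A ]→ (m' ⊗ n')

data _⇛_ {na nl : ℕ} : Mon na nl → Verdict → Set where
  evV     : ∀ {v} → verd v ⇛ v
  ⊕end    : ∀ {m n} → m ⇛ End → n ⇛ End → (m ⊕ n) ⇛ End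
  ⊗end    : ∀ {m n} → m ⇛ End → n ⇛ End → (m ⊗ n) ⇛ End
  ⊕yesL   : ∀ {m n} → m ⇛ Yes → (m ⊕ n) ⇛ Yes
  ⊕yesR   : ∀ {m n} → n ⇛ Yes → (m ⊕ n) ⇛ Yes
  ⊗noL    : ∀ {m n} → m ⇛ No → (m ⊗ n) ⇛ No
  ⊗noR    : ∀ {m n} → n ⇛ No → (m ⊗ n) ⇛ No
  +L      : ∀ {m n v} → m ⇛ v → (m +ₘ n) ⇛ v
  +R      : ∀ {m n v} → n ⇛ v → (m +ₘ n) ⇛ v
  ⊕noL    : ∀ {m n v} → m ⇛ No → n ⇛ v → (m ⊕ n) ⇛ v
  ⊕noR    : ∀ {m n v} → n ⇛ No → m ⇛ v → (m ⊕ n) ⇛ v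
  ⊗yesL   : ∀ {m n v} → m ⇛ Yes → n ⇛ v → (m ⊗ n) ⇛ v
  ⊗yesR   : ∀ {m n v} → n ⇛ Yes → m ⇛ v → (m ⊗ n) ⇛ v
  recE    : ∀ {x m v} → (m [ rec x m / x ]) ⇛ v → rec x m ⇛ v

data Conf (na nl : ℕ) : Set where
  _▷_ : Mon na nl → HTrc na nl → Conf na nl
  ⟪_⟫ : Verdict → Conf na nl

data _↣_ {na nl : ℕ} : Conf na nl → Conf na nl → Set where
  stepI : ∀ {m m' T T' A} → m ─[ A ]→ m' → TStep T A T' → (m ▷ T) ↣ (m' ▷ T')
  evalI : ∀ {m T v} → m ⇛ v → (m ▷ T) ↣ ⟪ v ⟫

_↣*_ : ∀ {na nl} → Conf na nl → Conf na nl → Set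
_↣*_ = Star _↣_

plusAll : ∀ {na nl} → Mon na nl → List (Mon na nl) → Mon na nl
plusAll m [] = m
plusAll m (n ∷ ns) = m +ₘ plusAll n ns

guardM : ∀ {na nl} → Act na → Loc nl → Mon na nl → Verdict → Mon na nl
guardM {na} a ℓ m v =
  plusAll (pre a ℓ m) (map (λ b → pre b ℓ (verd v)) (filter (λ b → ¬? (b ≟F a)) (allFin (suc (suc na)))))

bigOp : ∀ {A : Set} {k} → (A → A → A) → (Fin (suc k) → A) → A
bigOp {k = zero} op f = f zero
bigOp {k = suc k} op f = op (f zero) (bigOp op (f ∘ suc))

bool2v : ∀ {A : Set} → Relation.Nullary.Dec A → Verdict
bool2v (yes _) = Yes
bool2v (no _) = No

-- 𝓜_σ(φ); the min case is outside Hyper-maxHML (never used) and mapped to end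
𝓜 : ∀ {na nl} → (ℕ → Loc nl) → Form na → Mon na nl
𝓜 σ TT = verd Yes
𝓜 σ FF = verd No
𝓜 σ (φ ∧ᶠ ψ) = 𝓜 σ φ ⊗ 𝓜 σ ψ
𝓜 σ (φ ∨ᶠ ψ) = 𝓜 σ φ ⊕ 𝓜 σ ψ
𝓜 σ (max x φ) = rec x (𝓜 σ φ)
𝓜 σ (min x φ) = verd End
𝓜 σ (var x) = mvar x
𝓜 σ (exs π φ) = bigOp _⊕_ (λ ℓ → 𝓜 (upd σ π ℓ) φ)
𝓜 σ (alls π φ) = bigOp _⊗_ (λ ℓ → 𝓜 (upd σ π ℓ) φ)
𝓜 σ (π =ᶠ π') = verd (bool2v (σ π ≟F σ π'))
𝓜 σ (π ≠ᶠ π') = verd (bool2v (¬? (σ π ≟F σ π')))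
𝓜 σ (box a π φ) = guardM a (σ π) (𝓜 σ φ) Yes
𝓜 σ (dia a π φ) = guardM a (σ π) (𝓜 σ φ) No

𝓜∅ : ∀ {na nl} → Form na → Mon na nl
𝓜∅ = 𝓜 σ∅

{-# OPTIONS --safe #-}

-- We prove the contrapositive (by excluded middle): if the synthesised monitor does not reject T,
-- then T satisfies φ. The induction on φ runs over open formulas whose free recursion variables
-- are instantiated by closed monitors whose unrejected traces lie in the interpretation of the
-- variable. At max x ψ the unrejected traces of the instantiated monitor rec x m form a
-- post-fixed point of ψ, since a rejection by the unfolding m[rec x m/x] is one by rec x m.
-- Operationally, closed guarded monitors can always step, so a rejection by one operand of ⊗,
-- or by both operands of ⊕, is replayed by the compound monitor.
module Submission where

open import Defs
open import Level using (0ℓ; lift)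
open import Data.Nat using (ℕ; zero; suc)
open import Data.Nat.Properties using () renaming (_≟_ to _≟ℕ_)
open import Data.Fin using (Fin; zero; suc)
open import Data.Fin.Properties using (¬∀⟶∃¬) renaming (_≟_ to _≟F_)
open import Data.List using (List; []; _∷_; map; filter; allFin)
open import Data.List.Properties using (map-∘)
open import Data.List.Membership.Propositional using (_∈_; _∉_)
open import Data.List.Membership.Propositional.Properties using (∈-map⁺; ∈-filter⁺; ∈-allFin)
open import Data.List.Relation.Unary.Any using (here; there)
open import Data.List.Relation.Unary.All as All using (All; []; _∷_)
open import Data.List.Relation.Unary.All.Properties using (map⁺)
open import Data.List.Relation.Binary.Subset.Propositional using (_⊆_)
open import Data.List.Relation.Binary.Subset.Propositional.Properties using (∷⁺ʳ)
open import Data.Maybe using (Maybe; just; nothing; fromMaybe)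
open import Data.Product using (∃; _×_; _,_; proj₂)
open import Data.Sum using (inj₁; inj₂)
open import Data.Unit using (tt)
open import Data.Empty using (⊥-elim)
open import Function using (_∘_)
open import Relation.Nullary using (¬_; yes; no; ¬?)
open import Relation.Binary.PropositionalEquality
  using (_≡_; _≢_; refl; sym; trans; cong; cong₂; subst; module ≡-Reasoning)
open import Relation.Binary.Construct.Closure.ReflexiveTransitive using (ε; _◅_)
open import Axiom.ExcludedMiddle using (ExcludedMiddle)

module _ {a} {A : Set a} (f : ℕ → A) where

  upd-≡ : ∀ x v → upd f x v x ≡ v
  upd-≡ x v with x ≟ℕ x
  ... | yes _   = refl
  ... | no x≢x = ⊥-elim (x≢x refl)

  upd-≢ : ∀ x v {y} → y ≢ x → upd f x v y ≡ f y
  upd-≢ x v {y} y≢x with y ≟ℕ x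
  ... | yes y≡x = ⊥-elim (y≢x y≡x)
  ... | no _    = refl

  upd-id : ∀ x v → f x ≡ v → ∀ y → upd f x v y ≡ f y
  upd-id x v fx≡v y with y ≟ℕ x
  ... | yes refl = sym fx≡v
  ... | no _     = refl

  upd-cong : ∀ {g : ℕ → A} x v → (∀ y → f y ≡ g y) → ∀ y → upd f x v y ≡ upd g x v y
  upd-cong x v f≗g y with y ≟ℕ x
  ... | yes _ = refl
  ... | no _  = f≗g y

  upd-shadow : ∀ x v w y → upd (upd f x v) x w y ≡ upd f x w y
  upd-shadow x v w y with y ≟ℕ x
  ... | yes _   = refl
  ... | no y≢x = upd-≢ x v y≢x

  upd-comm : ∀ x v z w → x ≢ z → ∀ y → upd (upd f x v) z w y ≡ upd (upd f z w) x v y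
  upd-comm x v z w x≢z y with y ≟ℕ z | y ≟ℕ x
  ... | yes refl | yes refl = ⊥-elim (x≢z refl)
  ... | yes refl | no y≢x   = sym (upd-≡ y w)
  ... | no _     | yes refl = upd-≡ y v
  ... | no y≢z   | no y≢x   = trans (upd-≢ x v y≢x) (sym (upd-≢ z w y≢z))

bigOp-closed : ∀ {A : Set} {P : A → Set} {op : A → A → A} {k} (f : Fin (suc k) → A) →
               (∀ {a b} → P a → P b → P (op a b)) → (∀ i → P (f i)) → P (bigOp op f)
bigOp-closed {k = zero}  f closed Pf = Pf zero
bigOp-closed {P = P} {op} {suc k} f closed Pf =
  closed (Pf zero) (bigOp-closed {P = P} {op} (f ∘ suc) closed (Pf ∘ suc))

bigOp-map : ∀ {A B : Set} {op : A → A → A} {op′ : B → B → B} {k} (h : A → B) →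
            (∀ a b → h (op a b) ≡ op′ (h a) (h b)) →
            (f : Fin (suc k) → A) → h (bigOp op f) ≡ bigOp op′ (h ∘ f)
bigOp-map {k = zero}  h hom f = refl
bigOp-map {op′ = op′} {k = suc k} h hom f =
  trans (hom _ _) (cong (op′ (h (f zero))) (bigOp-map h hom (f ∘ suc)))

module _ {na nl : ℕ} where

  private
    M : Set
    M = Mon na nl

  data WF : List ℕ → List ℕ → M → Set where
    wf-verd : ∀ {Γ G v} → WF Γ G (verd v)
    wf-pre  : ∀ {Γ G a ℓ m} → WF Γ [] m → WF Γ G (pre a ℓ m)
    wf-+    : ∀ {Γ G m n} → WF Γ G m → WF Γ G n → WF Γ G (m +ₘ n)
    wf-⊕    : ∀ {Γ G m n} → WF Γ G m → WF Γ G n → WF Γ G (m ⊕ n)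
    wf-⊗    : ∀ {Γ G m n} → WF Γ G m → WF Γ G n → WF Γ G (m ⊗ n)
    wf-rec  : ∀ {Γ G x m} → WF (x ∷ Γ) (x ∷ G) m → WF Γ G (rec x m)
    wf-var  : ∀ {Γ G x} → x ∈ Γ → x ∉ G → WF Γ G (mvar x)

  ClosedGuarded : M → Set
  ClosedGuarded = WF [] []

  WF-weaken : ∀ {Γ G Γ′ G′ m} → WF Γ G m → Γ ⊆ Γ′ → (∀ {z} → z ∈ Γ → z ∈ G′ → z ∈ G) →
              WF Γ′ G′ m
  WF-weaken wf-verd       s t = wf-verd
  WF-weaken (wf-pre w)    s t = wf-pre (WF-weaken w s λ _ ())
  WF-weaken (wf-+ w w′)   s t = wf-+ (WF-weaken w s t) (WF-weaken w′ s t)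
  WF-weaken (wf-⊕ w w′)   s t = wf-⊕ (WF-weaken w s t) (WF-weaken w′ s t)
  WF-weaken (wf-⊗ w w′)   s t = wf-⊗ (WF-weaken w s t) (WF-weaken w′ s t)
  WF-weaken {Γ} {G} {G′ = G′} (wf-rec {x = x} w) s t = wf-rec (WF-weaken w (∷⁺ʳ x s) t′)
    where
    t′ : ∀ {z} → z ∈ x ∷ Γ → z ∈ x ∷ G′ → z ∈ x ∷ G
    t′ _         (here z≡x) = here z≡x
    t′ (here z≡x) (there _) = here z≡x
    t′ (there p)  (there q) = there (t p q)
  WF-weaken (wf-var p q)  s t = wf-var (s p) (q ∘ t p)

  ClosedGuarded⇒WF : ∀ {Γ G m} → ClosedGuarded m → WF Γ G m
  ClosedGuarded⇒WF w = WF-weaken w (λ ()) (λ ())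

  Env : Set
  Env = ℕ → Maybe M

  θ∅ : Env
  θ∅ _ = nothing

  -- No capture-avoidance is needed: the substituted monitors are always closed (ClosedEnv).
  sub : Env → M → M
  sub θ (verd v)    = verd v
  sub θ (pre a ℓ m) = pre a ℓ (sub θ m)
  sub θ (m +ₘ n)    = sub θ m +ₘ sub θ n
  sub θ (m ⊕ n)     = sub θ m ⊕ sub θ n
  sub θ (m ⊗ n)     = sub θ m ⊗ sub θ n
  sub θ (rec x m)   = rec x (sub (upd θ x nothing) m)
  sub θ (mvar x)    = fromMaybe (mvar x) (θ x)

  ClosedEnv : Env → Set
  ClosedEnv θ = ∀ z {n} → θ z ≡ just n → ClosedGuarded n

  Covers : Env → List ℕ → Set
  Covers θ Γ = ∀ {z} → z ∈ Γ → θ z ≢ nothing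

  ClosedEnv-θ∅ : ClosedEnv θ∅
  ClosedEnv-θ∅ _ ()

  ClosedEnv-unbind : ∀ {θ} x → ClosedEnv θ → ClosedEnv (upd θ x nothing)
  ClosedEnv-unbind x c z eq with z ≟ℕ x
  ClosedEnv-unbind x c z ()  | yes _
  ClosedEnv-unbind x c z eq  | no _ = c z eq

  ClosedEnv-bind : ∀ {θ R} x → ClosedEnv θ → ClosedGuarded R → ClosedEnv (upd θ x (just R))
  ClosedEnv-bind x c cR z eq with z ≟ℕ x
  ClosedEnv-bind x c cR z refl | yes _ = cR
  ClosedEnv-bind x c cR z eq   | no _  = c z eq

  Covers-bind : ∀ {θ Γ R} x → Covers θ Γ → Covers (upd θ x (just R)) (x ∷ Γ)
  Covers-bind x cv {z} p eq with z ≟ℕ x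
  Covers-bind x cv p ()        | yes _
  Covers-bind x cv (here z≡x) eq | no z≢x = z≢x z≡x
  Covers-bind x cv (there p)  eq | no _   = cv p eq

  sub-cong : ∀ {θ θ′} → (∀ z → θ z ≡ θ′ z) → ∀ m → sub θ m ≡ sub θ′ m
  sub-cong e (verd v)    = refl
  sub-cong e (pre a ℓ m) = cong (pre a ℓ) (sub-cong e m)
  sub-cong e (m +ₘ n)    = cong₂ _+ₘ_ (sub-cong e m) (sub-cong e n)
  sub-cong e (m ⊕ n)     = cong₂ _⊕_ (sub-cong e m) (sub-cong e n)
  sub-cong e (m ⊗ n)     = cong₂ _⊗_ (sub-cong e m) (sub-cong e n)
  sub-cong {θ} e (rec x m) = cong (rec x) (sub-cong (upd-cong θ x nothing e) m)
  sub-cong e (mvar x)    = cong (fromMaybe (mvar x)) (e x)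

  sub-θ∅ : ∀ m → sub θ∅ m ≡ m
  sub-θ∅ (verd v)    = refl
  sub-θ∅ (pre a ℓ m) = cong (pre a ℓ) (sub-θ∅ m)
  sub-θ∅ (m +ₘ n)    = cong₂ _+ₘ_ (sub-θ∅ m) (sub-θ∅ n)
  sub-θ∅ (m ⊕ n)     = cong₂ _⊕_ (sub-θ∅ m) (sub-θ∅ n)
  sub-θ∅ (m ⊗ n)     = cong₂ _⊗_ (sub-θ∅ m) (sub-θ∅ n)
  sub-θ∅ (rec x m)   = cong (rec x) (trans (sub-cong (upd-id θ∅ x nothing refl) m) (sub-θ∅ m))
  sub-θ∅ (mvar x)    = refl

  [/]-fresh : ∀ {Γ G n} R x → WF Γ G n → x ∉ Γ → n [ R / x ] ≡ n
  [/]-fresh R x wf-verd      x∉Γ = refl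
  [/]-fresh R x (wf-pre w)   x∉Γ = cong (pre _ _) ([/]-fresh R x w x∉Γ)
  [/]-fresh R x (wf-+ w w′)  x∉Γ = cong₂ _+ₘ_ ([/]-fresh R x w x∉Γ) ([/]-fresh R x w′ x∉Γ)
  [/]-fresh R x (wf-⊕ w w′)  x∉Γ = cong₂ _⊕_ ([/]-fresh R x w x∉Γ) ([/]-fresh R x w′ x∉Γ)
  [/]-fresh R x (wf-⊗ w w′)  x∉Γ = cong₂ _⊗_ ([/]-fresh R x w x∉Γ) ([/]-fresh R x w′ x∉Γ)
  [/]-fresh R x (wf-rec {x = y} w) x∉Γ with y ≟ℕ x
  ... | yes _   = refl
  ... | no y≢x = cong (rec y) ([/]-fresh R x w x∉y∷Γ)
    where
    x∉y∷Γ : x ∉ y ∷ _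
    x∉y∷Γ (here x≡y) = y≢x (sym x≡y)
    x∉y∷Γ (there p)  = x∉Γ p
  [/]-fresh R x (wf-var {x = z} p q) x∉Γ with z ≟ℕ x
  ... | yes refl = ⊥-elim (x∉Γ p)
  ... | no _     = refl

  sub-[/] : ∀ {θ} x R m → ClosedEnv θ → θ x ≡ nothing →
            sub θ m [ R / x ] ≡ sub (upd θ x (just R)) m
  sub-[/] x R (verd v)    c e = refl
  sub-[/] x R (pre a ℓ m) c e = cong (pre a ℓ) (sub-[/] x R m c e)
  sub-[/] x R (m +ₘ n)    c e = cong₂ _+ₘ_ (sub-[/] x R m c e) (sub-[/] x R n c e)
  sub-[/] x R (m ⊕ n)     c e = cong₂ _⊕_ (sub-[/] x R m c e) (sub-[/] x R n c e)
  sub-[/] x R (m ⊗ n)     c e = cong₂ _⊗_ (sub-[/] x R m c e) (sub-[/] x R n c e)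
  sub-[/] {θ} x R (rec y m) c e with y ≟ℕ x
  ... | yes refl = cong (rec y) (sub-cong (λ z → sym (upd-shadow θ y (just R) nothing z)) m)
  ... | no y≢x  = cong (rec y) (trans
        (sub-[/] x R m (ClosedEnv-unbind y c) (trans (upd-≢ θ y nothing (y≢x ∘ sym)) e))
        (sub-cong (upd-comm θ y nothing x (just R) y≢x) m))
  sub-[/] {θ} x R (mvar z) c e with θ z in eq
  ... | just n with z ≟ℕ x
  ...   | yes refl with () ← trans (sym eq) e
  ...   | no _ rewrite eq = [/]-fresh R x (c z eq) (λ ())
  sub-[/] {θ} x R (mvar z) c e | nothing with z ≟ℕ x
  ...   | yes refl = refl
  ...   | no _ rewrite eq = refl

  sub-unfold : ∀ {θ} x R m → ClosedEnv θ →
               sub (upd θ x nothing) m [ R / x ] ≡ sub (upd θ x (just R)) m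
  sub-unfold {θ} x R m c =
    trans (sub-[/] x R m (ClosedEnv-unbind x c) (upd-≡ θ x nothing))
          (sub-cong (upd-shadow θ x nothing (just R)) m)

  WF-sub : ∀ {Γ G Δ G′ θ m} → WF Γ G m → ClosedEnv θ →
           (∀ {z} → z ∈ Γ → θ z ≡ nothing → z ∈ Δ) →
           (∀ {z} → z ∈ Γ → θ z ≡ nothing → z ∈ G′ → z ∈ G) → WF Δ G′ (sub θ m)
  WF-sub wf-verd      c s t = wf-verd
  WF-sub (wf-pre w)   c s t = wf-pre (WF-sub w c s λ _ _ ())
  WF-sub (wf-+ w w′)  c s t = wf-+ (WF-sub w c s t) (WF-sub w′ c s t)
  WF-sub (wf-⊕ w w′)  c s t = wf-⊕ (WF-sub w c s t) (WF-sub w′ c s t)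
  WF-sub (wf-⊗ w w′)  c s t = wf-⊗ (WF-sub w c s t) (WF-sub w′ c s t)
  WF-sub {Γ} {G} {Δ} {G′} {θ} (wf-rec {x = x} w) c s t =
    wf-rec (WF-sub w (ClosedEnv-unbind x c) s′ t′)
    where
    s′ : ∀ {z} → z ∈ x ∷ Γ → upd θ x nothing z ≡ nothing → z ∈ x ∷ Δ
    s′ (here z≡x) _ = here z≡x
    s′ {z} (there p) eq with z ≟ℕ x
    ... | yes z≡x = here z≡x
    ... | no _    = there (s p eq)
    t′ : ∀ {z} → z ∈ x ∷ Γ → upd θ x nothing z ≡ nothing → z ∈ x ∷ G′ → z ∈ x ∷ G
    t′ _          _  (here z≡x) = here z≡x
    t′ (here z≡x) _  (there _)  = here z≡x
    t′ {z} (there p) eq (there q) with z ≟ℕ x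
    ... | yes z≡x = here z≡x
    ... | no _    = there (t p eq q)
  WF-sub {θ = θ} (wf-var {x = z} p q) c s t with θ z in eq
  ... | just n  = ClosedGuarded⇒WF (c z eq)
  ... | nothing = wf-var (s p eq) (q ∘ t p eq)

  WF-sub-closed : ∀ {Γ G θ m} → WF Γ G m → ClosedEnv θ → Covers θ Γ → ClosedGuarded (sub θ m)
  WF-sub-closed w c cv = WF-sub w c (λ p eq → ⊥-elim (cv p eq)) (λ p eq _ → ⊥-elim (cv p eq))

  ClosedGuarded-unfold : ∀ {x m} → ClosedGuarded (rec x m) → ClosedGuarded (m [ rec x m / x ])
  ClosedGuarded-unfold {x} {m} cg@(wf-rec w) =
    subst ClosedGuarded unrolled
      (WF-sub-closed w (ClosedEnv-bind x ClosedEnv-θ∅ cg) (Covers-bind x λ ()))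
    where
    open ≡-Reasoning
    unrolled : sub (upd θ∅ x (just (rec x m))) m ≡ m [ rec x m / x ]
    unrolled = begin
      sub (upd θ∅ x (just (rec x m))) m         ≡⟨ sym (sub-unfold x (rec x m) m ClosedEnv-θ∅) ⟩
      sub (upd θ∅ x nothing) m [ rec x m / x ]
        ≡⟨ cong (_[ rec x m / x ]) (sub-cong (upd-id θ∅ x nothing refl) m) ⟩
      sub θ∅ m [ rec x m / x ]                  ≡⟨ cong (_[ rec x m / x ]) (sub-θ∅ m) ⟩
      m [ rec x m / x ]                         ∎

  ClosedGuarded-step : ∀ {m m′ A} → ClosedGuarded m → m ─[ A ]→ m′ → ClosedGuarded m′
  ClosedGuarded-step w           vS            = w
  ClosedGuarded-step (wf-pre w)  (preT _)      = w
  ClosedGuarded-step w           (preF _)      = wf-verd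
  ClosedGuarded-step w           (recS s)      = ClosedGuarded-step (ClosedGuarded-unfold w) s
  ClosedGuarded-step (wf-+ w w′) (plusL s)     = ClosedGuarded-step w s
  ClosedGuarded-step (wf-+ w w′) (plusR s)     = ClosedGuarded-step w′ s
  ClosedGuarded-step (wf-⊕ w w′) (oplusS s t)  =
    wf-⊕ (ClosedGuarded-step w s) (ClosedGuarded-step w′ t)
  ClosedGuarded-step (wf-⊗ w w′) (otimesS s t) =
    wf-⊗ (ClosedGuarded-step w s) (ClosedGuarded-step w′ t)

  sub-progress : ∀ {Γ θ} m → WF Γ Γ m → ClosedEnv θ → Covers θ Γ →
                 ∀ A → ∃ λ m′ → sub θ m ─[ A ]→ m′
  sub-progress (verd v) w c cv A = verd v , vS
  sub-progress {θ = θ} (pre a ℓ m) w c cv A with A ℓ ≟F a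
  ... | yes Aℓ≡a = sub θ m , preT Aℓ≡a
  ... | no Aℓ≢a  = verd End , preF Aℓ≢a
  sub-progress (m +ₘ n) (wf-+ w w′) c cv A =
    let m′ , s = sub-progress m w c cv A in m′ , plusL s
  sub-progress (m ⊕ n) (wf-⊕ w w′) c cv A =
    let m′ , s = sub-progress m w c cv A
        n′ , t = sub-progress n w′ c cv A
    in m′ ⊕ n′ , oplusS s t
  sub-progress (m ⊗ n) (wf-⊗ w w′) c cv A =
    let m′ , s = sub-progress m w c cv A
        n′ , t = sub-progress n w′ c cv A
    in m′ ⊗ n′ , otimesS s t
  sub-progress {θ = θ} (rec x m) (wf-rec w) c cv A =
    let R = sub θ (rec x m)
        m′ , s = sub-progress m w (ClosedEnv-bind x c (WF-sub-closed (wf-rec w) c cv))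
                                  (Covers-bind x cv) A
    in m′ , recS (subst (_─[ A ]→ m′) (sym (sub-unfold x R m c)) s)
  sub-progress (mvar x) (wf-var p q) c cv A = ⊥-elim (q p)

  progress : ∀ {m} → ClosedGuarded m → ∀ A → ∃ λ m′ → m ─[ A ]→ m′
  progress {m} w A =
    let m′ , s = sub-progress m w ClosedEnv-θ∅ (λ ()) A in m′ , subst (_─[ A ]→ m′) (sub-θ∅ m) s

  -- Needed because ⊕ reports the verdict of one operand only once the other one has said no.
  verdict-persists : ∀ {m v} → ClosedGuarded m → m ⇛ v → ∀ A → ∃ λ m′ → m ─[ A ]→ m′ × m′ ⇛ v
  verdict-persists w evV A = _ , vS , evV
  verdict-persists (wf-⊕ w w′) (⊕end p q) A with verdict-persists w p A | verdict-persists w′ q A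
  ... | _ , s , p′ | _ , t , q′ = _ , oplusS s t , ⊕end p′ q′
  verdict-persists (wf-⊗ w w′) (⊗end p q) A with verdict-persists w p A | verdict-persists w′ q A
  ... | _ , s , p′ | _ , t , q′ = _ , otimesS s t , ⊗end p′ q′
  verdict-persists (wf-⊕ w w′) (⊕yesL p) A with verdict-persists w p A | progress w′ A
  ... | _ , s , p′ | _ , t = _ , oplusS s t , ⊕yesL p′
  verdict-persists (wf-⊕ w w′) (⊕yesR q) A with progress w A | verdict-persists w′ q A
  ... | _ , s | _ , t , q′ = _ , oplusS s t , ⊕yesR q′
  verdict-persists (wf-⊗ w w′) (⊗noL p) A with verdict-persists w p A | progress w′ A
  ... | _ , s , p′ | _ , t = _ , otimesS s t , ⊗noL p′
  verdict-persists (wf-⊗ w w′) (⊗noR q) A with progress w A | verdict-persists w′ q A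
  ... | _ , s | _ , t , q′ = _ , otimesS s t , ⊗noR q′
  verdict-persists (wf-+ w w′) (+L p) A with verdict-persists w p A
  ... | _ , s , p′ = _ , plusL s , p′
  verdict-persists (wf-+ w w′) (+R q) A with verdict-persists w′ q A
  ... | _ , t , q′ = _ , plusR t , q′
  verdict-persists (wf-⊕ w w′) (⊕noL p q) A with verdict-persists w p A | verdict-persists w′ q A
  ... | _ , s , p′ | _ , t , q′ = _ , oplusS s t , ⊕noL p′ q′
  verdict-persists (wf-⊕ w w′) (⊕noR q p) A with verdict-persists w p A | verdict-persists w′ q A
  ... | _ , s , p′ | _ , t , q′ = _ , oplusS s t , ⊕noR q′ p′
  verdict-persists (wf-⊗ w w′) (⊗yesL p q) A with verdict-persists w p A | verdict-persists w′ q A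
  ... | _ , s , p′ | _ , t , q′ = _ , otimesS s t , ⊗yesL p′ q′
  verdict-persists (wf-⊗ w w′) (⊗yesR q p) A with verdict-persists w p A | verdict-persists w′ q A
  ... | _ , s , p′ | _ , t , q′ = _ , otimesS s t , ⊗yesR q′ p′
  verdict-persists w (recE p) A with verdict-persists (ClosedGuarded-unfold w) p A
  ... | _ , s , p′ = _ , recS s , p′

  -- Consuming T through hd and tl, rather than through an arbitrary TStep decomposition,
  -- avoids function extensionality.
  data Rejects : M → HTrc na nl → Set where
    now   : ∀ {m T} → m ⇛ No → Rejects m T
    later : ∀ {m m′ T} → m ─[ hd T ]→ m′ → Rejects m′ (tl T) → Rejects m T

  Rejects⇒↣* : ∀ {m T} → Rejects m T → (m ▷ T) ↣* ⟪ No ⟫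
  Rejects⇒↣* (now p)     = evalI p ◅ ε
  Rejects⇒↣* (later s r) = stepI s (λ ℓ → refl , λ k → refl) ◅ Rejects⇒↣* r

  rejects-rec : ∀ {x m T} → Rejects (m [ rec x m / x ]) T → Rejects (rec x m) T
  rejects-rec (now p)     = now (recE p)
  rejects-rec (later s r) = later (recS s) r

  rejects-⊗ˡ : ∀ {m n T} → ClosedGuarded m → ClosedGuarded n → Rejects m T → Rejects (m ⊗ n) T
  rejects-⊗ˡ w w′ (now p) = now (⊗noL p)
  rejects-⊗ˡ {T = T} w w′ (later s r) =
    let _ , t = progress w′ (hd T)
    in later (otimesS s t) (rejects-⊗ˡ (ClosedGuarded-step w s) (ClosedGuarded-step w′ t) r)

  rejects-⊗ʳ : ∀ {m n T} → ClosedGuarded m → ClosedGuarded n → Rejects n T → Rejects (m ⊗ n) T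
  rejects-⊗ʳ w w′ (now q) = now (⊗noR q)
  rejects-⊗ʳ {T = T} w w′ (later t r) =
    let _ , s = progress w (hd T)
    in later (otimesS s t) (rejects-⊗ʳ (ClosedGuarded-step w s) (ClosedGuarded-step w′ t) r)

  rejects-⊕-noˡ : ∀ {m n T} → ClosedGuarded m → ClosedGuarded n → m ⇛ No → Rejects n T →
                  Rejects (m ⊕ n) T
  rejects-⊕-noˡ w w′ p (now q) = now (⊕noL p q)
  rejects-⊕-noˡ {T = T} w w′ p (later t r) =
    let _ , s , p′ = verdict-persists w p (hd T)
    in later (oplusS s t) (rejects-⊕-noˡ (ClosedGuarded-step w s) (ClosedGuarded-step w′ t) p′ r)

  rejects-⊕-noʳ : ∀ {m n T} → ClosedGuarded m → ClosedGuarded n → n ⇛ No → Rejects m T →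
                  Rejects (m ⊕ n) T
  rejects-⊕-noʳ w w′ q (now p) = now (⊕noR q p)
  rejects-⊕-noʳ {T = T} w w′ q (later s r) =
    let _ , t , q′ = verdict-persists w′ q (hd T)
    in later (oplusS s t) (rejects-⊕-noʳ (ClosedGuarded-step w s) (ClosedGuarded-step w′ t) q′ r)

  rejects-⊕ : ∀ {m n T} → ClosedGuarded m → ClosedGuarded n → Rejects m T → Rejects n T →
              Rejects (m ⊕ n) T
  rejects-⊕ w w′ (now p)        r′           = rejects-⊕-noˡ w w′ p r′
  rejects-⊕ w w′ r@(later _ _) (now q)      = rejects-⊕-noʳ w w′ q r
  rejects-⊕ w w′ (later s r) (later t r′) =
    later (oplusS s t) (rejects-⊕ (ClosedGuarded-step w s) (ClosedGuarded-step w′ t) r r′)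

  rejects-bigOp⊕ : ∀ {k T} (f : Fin (suc k) → M) → (∀ i → ClosedGuarded (f i)) →
                   (∀ i → Rejects (f i) T) → Rejects (bigOp _⊕_ f) T
  rejects-bigOp⊕ {T = T} f w r =
    proj₂ (bigOp-closed {P = λ m → ClosedGuarded m × Rejects m T} f
             (λ (w₁ , r₁) (w₂ , r₂) → wf-⊕ w₁ w₂ , rejects-⊕ w₁ w₂ r₁ r₂) (λ i → w i , r i))

  rejects-bigOp⊗ : ∀ {k T} (f : Fin (suc k) → M) → (∀ i → ClosedGuarded (f i)) →
                   ∀ i → Rejects (f i) T → Rejects (bigOp _⊗_ f) T
  rejects-bigOp⊗ {zero}  f w zero    r = r
  rejects-bigOp⊗ {suc k} f w zero    r =
    rejects-⊗ˡ (w zero) (bigOp-closed {P = ClosedGuarded} (f ∘ suc) wf-⊗ (w ∘ suc)) r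
  rejects-bigOp⊗ {suc k} f w (suc i) r =
    rejects-⊗ʳ (w zero) (bigOp-closed {P = ClosedGuarded} (f ∘ suc) wf-⊗ (w ∘ suc))
      (rejects-bigOp⊗ (f ∘ suc) (w ∘ suc) i r)

  sub-bigOp⊕ : ∀ θ {k} (f : Fin (suc k) → M) → sub θ (bigOp _⊕_ f) ≡ bigOp _⊕_ (sub θ ∘ f)
  sub-bigOp⊕ θ = bigOp-map (sub θ) (λ _ _ → refl)

  sub-bigOp⊗ : ∀ θ {k} (f : Fin (suc k) → M) → sub θ (bigOp _⊗_ f) ≡ bigOp _⊗_ (sub θ ∘ f)
  sub-bigOp⊗ θ = bigOp-map (sub θ) (λ _ _ → refl)

  plusAll-stepˡ : ∀ {m m′ : M} {A} ns → m ─[ A ]→ m′ → plusAll m ns ─[ A ]→ m′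
  plusAll-stepˡ []      s = s
  plusAll-stepˡ (_ ∷ _) s = plusL s

  plusAll-step∈ : ∀ {m n n′ : M} {A} ns → n ∈ ns → n ─[ A ]→ n′ → plusAll m ns ─[ A ]→ n′
  plusAll-step∈ (_ ∷ ns) (here refl) s = plusR (plusAll-stepˡ ns s)
  plusAll-step∈ (_ ∷ ns) (there p)   s = plusR (plusAll-step∈ ns p s)

  sub-plusAll : ∀ θ m ns → sub θ (plusAll m ns) ≡ plusAll (sub θ m) (map (sub θ) ns)
  sub-plusAll θ m []       = refl
  sub-plusAll θ m (n ∷ ns) = cong (sub θ m +ₘ_) (sub-plusAll θ n ns)

  WF-plusAll : ∀ {Γ G m ns} → WF Γ G m → All (WF Γ G) ns → WF Γ G (plusAll m ns)
  WF-plusAll w []        = w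
  WF-plusAll w (w′ ∷ ws) = wf-+ w (WF-plusAll w′ ws)

  otherActions : Act na → List (Act na)
  otherActions a = filter (λ b → ¬? (b ≟F a)) (allFin (suc (suc na)))

  sub-guardM : ∀ θ a ℓ m v → sub θ (guardM a ℓ m v) ≡ guardM a ℓ (sub θ m) v
  sub-guardM θ a ℓ m v =
    trans (sub-plusAll θ (pre a ℓ m) _) (cong (plusAll _) (sym (map-∘ (otherActions a))))

  WF-guardM : ∀ {Γ G} a ℓ m v → WF Γ [] m → WF Γ G (guardM a ℓ m v)
  WF-guardM a ℓ m v w = WF-plusAll (wf-pre w) (map⁺ (All.universal (λ _ → wf-pre wf-verd) _))

  sub-guardM-step-≡ : ∀ {θ a ℓ m v A} → A ℓ ≡ a → sub θ (guardM a ℓ m v) ─[ A ]→ sub θ m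
  sub-guardM-step-≡ {θ} {a} {ℓ} {m} {v} Aℓ≡a =
    subst (_─[ _ ]→ sub θ m) (sym (sub-guardM θ a ℓ m v)) (plusAll-stepˡ _ (preT Aℓ≡a))

  sub-guardM-step-≢ : ∀ {θ a ℓ m v A} → A ℓ ≢ a → sub θ (guardM a ℓ m v) ─[ A ]→ verd v
  sub-guardM-step-≢ {θ} {a} {ℓ} {m} {v} {A} Aℓ≢a =
    subst (_─[ A ]→ verd v) (sym (sub-guardM θ a ℓ m v))
      (plusAll-step∈ _ (∈-map⁺ (λ b → pre b ℓ (verd v)) Aℓ∈others) (preT refl))
    where
    Aℓ∈others : A ℓ ∈ otherActions a
    Aℓ∈others = ∈-filter⁺ (λ b → ¬? (b ≟F a)) (∈-allFin (A ℓ)) Aℓ≢a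

  WF-𝓜 : ∀ {Ls Xs G} (φ : Form na) (σ : ℕ → Loc nl) → ClosedIn Ls Xs φ → GuardedIn G φ →
         WF Xs G (𝓜 σ φ)
  WF-𝓜 TT          σ c       g       = wf-verd
  WF-𝓜 FF          σ c       g       = wf-verd
  WF-𝓜 (φ ∧ᶠ ψ)    σ (c , d) (g , h) = wf-⊗ (WF-𝓜 φ σ c g) (WF-𝓜 ψ σ d h)
  WF-𝓜 (φ ∨ᶠ ψ)    σ (c , d) (g , h) = wf-⊕ (WF-𝓜 φ σ c g) (WF-𝓜 ψ σ d h)
  WF-𝓜 (max x φ)   σ c       g       = wf-rec (WF-𝓜 φ σ c g)
  WF-𝓜 (min x φ)   σ c       g       = wf-verd
  WF-𝓜 (var x)     σ c       g       = wf-var c g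
  WF-𝓜 (exs π φ)   σ c       g       =
    bigOp-closed {P = WF _ _} (λ ℓ → 𝓜 (upd σ π ℓ) φ) wf-⊕ (λ ℓ → WF-𝓜 φ (upd σ π ℓ) c g)
  WF-𝓜 (alls π φ)  σ c       g       =
    bigOp-closed {P = WF _ _} (λ ℓ → 𝓜 (upd σ π ℓ) φ) wf-⊗ (λ ℓ → WF-𝓜 φ (upd σ π ℓ) c g)
  WF-𝓜 (π =ᶠ π′)   σ c       g       = wf-verd
  WF-𝓜 (π ≠ᶠ π′)   σ c       g       = wf-verd
  WF-𝓜 (box a π φ) σ (_ , c) g       = WF-guardM a (σ π) _ Yes (WF-𝓜 φ σ c g)
  WF-𝓜 (dia a π φ) σ (_ , c) g       = WF-guardM a (σ π) _ No (WF-𝓜 φ σ c g)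

  record Adequate (Xs : List ℕ) (ρ : ℕ → Pred0 na nl) : Set₁ where
    field
      env    : Env
      closed : ClosedEnv env
      covers : Covers env Xs
      sound  : ∀ x {n T} → env x ≡ just n → ¬ Rejects n T → ρ x T

  open Adequate

  Adequate-∅ : Adequate [] ρ∅
  Adequate-∅ = record { env = θ∅ ; closed = ClosedEnv-θ∅ ; covers = λ () ; sound = λ _ () }

  Adequate-bind : ∀ {Xs ρ} (E : Adequate Xs ρ) x R → ClosedGuarded R →
                  Adequate (x ∷ Xs) (upd ρ x (λ T → ¬ Rejects R T))
  Adequate-bind {ρ = ρ} E x R cR = record
    { env    = upd (env E) x (just R)
    ; closed = ClosedEnv-bind x (closed E) cR
    ; covers = Covers-bind x (covers E)
    ; sound  = sound′
    }
    where
    sound′ : ∀ y {n T} → upd (env E) x (just R) y ≡ just n → ¬ Rejects n T →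
             upd ρ x (λ T → ¬ Rejects R T) y T
    sound′ y eq ¬r with y ≟ℕ x
    sound′ y refl ¬r | yes _ = ¬r
    sound′ y eq   ¬r | no _  = sound E y eq ¬r

  ClosedGuarded-𝓜 : ∀ {Ls Xs G ρ} (φ : Form na) → ClosedIn Ls Xs φ → GuardedIn G φ →
                    (E : Adequate Xs ρ) (σ : ℕ → Loc nl) → ClosedGuarded (sub (env E) (𝓜 σ φ))
  ClosedGuarded-𝓜 φ c g E σ = WF-sub-closed (WF-𝓜 φ σ c g) (closed E) (covers E)

  ¬Rejects⇒⟦max⟧ : ∀ {Xs ρ} x (ψ : Form na) (σ : ℕ → Loc nl) (E : Adequate Xs ρ) →
                   ClosedGuarded (sub (env E) (𝓜 σ (max x ψ))) →
                   (∀ {ρ′} (E′ : Adequate (x ∷ Xs) ρ′) T →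
                      ¬ Rejects (sub (env E′) (𝓜 σ ψ)) T → ⟦ ψ ⟧ ρ′ σ T) →
                   ∀ T → ¬ Rejects (sub (env E) (𝓜 σ (max x ψ))) T → ⟦ max x ψ ⟧ ρ σ T
  ¬Rejects⇒⟦max⟧ {ρ = ρ} x ψ σ E cR ih T ¬r = (λ T′ → ¬ Rejects R T′) , postfixed , ¬r
    where
    R = sub (env E) (𝓜 σ (max x ψ))
    postfixed : ∀ T′ → ¬ Rejects R T′ → ⟦ ψ ⟧ (upd ρ x (λ T → ¬ Rejects R T)) σ T′
    postfixed T′ ¬r′ = ih (Adequate-bind E x R cR) T′
      (¬r′ ∘ rejects-rec ∘ subst (λ m → Rejects m T′) (sym (sub-unfold x R (𝓜 σ ψ) (closed E))))

  ¬Rejects-bigOp⊕ : ExcludedMiddle 0ℓ → ∀ {T} (f : Loc nl → M) → (∀ ℓ → ClosedGuarded (f ℓ)) →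
                    ¬ Rejects (bigOp _⊕_ f) T → ∃ λ ℓ → ¬ Rejects (f ℓ) T
  ¬Rejects-bigOp⊕ lem {T} f w ¬r =
    ¬∀⟶∃¬ (suc nl) (λ ℓ → Rejects (f ℓ) T) (λ _ → lem) (¬r ∘ rejects-bigOp⊕ f w)

  module _ (lem : ExcludedMiddle 0ℓ) where

    ¬Rejects⇒⟦⟧ : ∀ {Ls Xs G ρ} (φ : Form na) → MaxOnly φ → ClosedIn Ls Xs φ → GuardedIn G φ →
                  (E : Adequate Xs ρ) (σ : ℕ → Loc nl) (T : HTrc na nl) →
                  ¬ Rejects (sub (env E) (𝓜 σ φ)) T → ⟦ φ ⟧ ρ σ T
    ¬Rejects⇒⟦⟧ TT mo c g E σ T ¬r = lift tt
    ¬Rejects⇒⟦⟧ FF mo c g E σ T ¬r = ⊥-elim (¬r (now evV))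
    ¬Rejects⇒⟦⟧ (φ ∧ᶠ ψ) (mo , mo′) (c , c′) (g , g′) E σ T ¬r =
      ¬Rejects⇒⟦⟧ φ mo c g E σ T (¬r ∘ rejects-⊗ˡ wφ wψ) ,
      ¬Rejects⇒⟦⟧ ψ mo′ c′ g′ E σ T (¬r ∘ rejects-⊗ʳ wφ wψ)
      where
      wφ = ClosedGuarded-𝓜 φ c g E σ
      wψ = ClosedGuarded-𝓜 ψ c′ g′ E σ
    ¬Rejects⇒⟦⟧ (φ ∨ᶠ ψ) (mo , mo′) (c , c′) (g , g′) E σ T ¬r
      with lem {Rejects (sub (env E) (𝓜 σ φ)) T}
    ... | no ¬rφ = inj₁ (¬Rejects⇒⟦⟧ φ mo c g E σ T ¬rφ)
    ... | yes rφ = inj₂ (¬Rejects⇒⟦⟧ ψ mo′ c′ g′ E σ T (¬r ∘ rejects-⊕ wφ wψ rφ))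
      where
      wφ = ClosedGuarded-𝓜 φ c g E σ
      wψ = ClosedGuarded-𝓜 ψ c′ g′ E σ
    ¬Rejects⇒⟦⟧ (max x ψ) mo c g E σ T ¬r =
      ¬Rejects⇒⟦max⟧ x ψ σ E (ClosedGuarded-𝓜 (max x ψ) c g E σ)
        (λ E′ → ¬Rejects⇒⟦⟧ ψ mo c g E′ σ) T ¬r
    ¬Rejects⇒⟦⟧ (var x) mo c g E σ T ¬r with env E x in eq
    ... | just n  = lift (sound E x eq ¬r)
    ... | nothing = ⊥-elim (covers E c eq)
    ¬Rejects⇒⟦⟧ (exs π ψ) mo c g E σ T ¬r =
      let ℓ , ¬rℓ = ¬Rejects-bigOp⊕ lem (sub (env E) ∘ 𝓜ψ) (ClosedGuarded-𝓜 ψ c g E ∘ upd σ π)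
                      (¬r ∘ subst (λ m → Rejects m T) (sym (sub-bigOp⊕ (env E) 𝓜ψ)))
      in ℓ , ¬Rejects⇒⟦⟧ ψ mo c g E (upd σ π ℓ) T ¬rℓ
      where
      𝓜ψ : Loc nl → M
      𝓜ψ ℓ = 𝓜 (upd σ π ℓ) ψ
    ¬Rejects⇒⟦⟧ (alls π ψ) mo c g E σ T ¬r ℓ =
      ¬Rejects⇒⟦⟧ ψ mo c g E (upd σ π ℓ) T
        (¬r ∘ subst (λ m → Rejects m T) (sym (sub-bigOp⊗ (env E) 𝓜ψ))
            ∘ rejects-bigOp⊗ (sub (env E) ∘ 𝓜ψ) (ClosedGuarded-𝓜 ψ c g E ∘ upd σ π) ℓ)
      where
      𝓜ψ : Loc nl → M
      𝓜ψ ℓ = 𝓜 (upd σ π ℓ) ψ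
    ¬Rejects⇒⟦⟧ (π =ᶠ π′) mo c g E σ T ¬r with σ π ≟F σ π′
    ... | yes σπ≡σπ′ = lift σπ≡σπ′
    ... | no _       = ⊥-elim (¬r (now evV))
    ¬Rejects⇒⟦⟧ (π ≠ᶠ π′) mo c g E σ T ¬r with σ π ≟F σ π′
    ... | yes _      = ⊥-elim (¬r (now evV))
    ... | no σπ≢σπ′  = lift σπ≢σπ′
    ¬Rejects⇒⟦⟧ (box a π ψ) mo (_ , c) g E σ T ¬r hdT≡a =
      ¬Rejects⇒⟦⟧ ψ mo c g E σ (tl T) (¬r ∘ later (sub-guardM-step-≡ hdT≡a))
    ¬Rejects⇒⟦⟧ (dia a π ψ) mo (_ , c) g E σ T ¬r with hd T (σ π) ≟F a
    ... | yes hdT≡a =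
      lift hdT≡a , ¬Rejects⇒⟦⟧ ψ mo c g E σ (tl T) (¬r ∘ later (sub-guardM-step-≡ hdT≡a))
    ... | no hdT≢a  = ⊥-elim (¬r (later (sub-guardM-step-≢ hdT≢a) (now evV)))

theorem3p8 : ExcludedMiddle 0ℓ → (na nl : ℕ) (φ : Form na) →
    MaxOnly φ → Closed φ → Guarded φ → DistinctBound φ →
    (T : HTrc na nl) → ¬ (⟦ φ ⟧∅ T) →
    (𝓜∅ φ ▷ T) ↣* ⟪ No ⟫
theorem3p8 lem na nl φ mo c g _ T ⊭φ with lem {Rejects (𝓜∅ φ) T}
... | yes r  = Rejects⇒↣* r
... | no ¬r = ⊥-elim (⊭φ (¬Rejects⇒⟦⟧ lem φ mo c g Adequate-∅ σ∅ T
                           (¬r ∘ subst (λ m → Rejects m T) (sub-θ∅ (𝓜∅ φ)))))
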